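{- Let $k\ge 1$, $S_L=\{1,\ldots,k\}$, and let $S_R$ be a set of $k$ positive integers. Then: (1) if $S_R=\{c+1,c+2,\ldots,c+k\}$ for some integer $c\ge 0$, then Left weakly dominates the game $(S_L,S_R)$ if $c>0$, and the game is impartial if $c=0$; (2) otherwise, Left strongly dominates the game $(S_L,S_R)$.
   Context: A partizan subtraction game $(S_L,S_R)$, with $S_L,S_R$ finite sets of positive integers, is played on a heap of $n$ tokens. Two players, Left and Right, alternate moves; Left removes $s\in S_L$ tokens and Right removes $s\in S_R$ tokens (at most the current heap size). A player unable to move loses. The outcome $o(n)$ is $\mathcal L$ (Left wins whoever starts), $\mathcal R$ (Right wins whoever starts), $\mathcal N$ (first player wins) or $\mathcal P$ (second player wins). The outcome sequence $o(0),o(1),\ldots$ is ultimately periodic. Left strongly dominates if the period consists only of $\mathcal L$ (i.e. $o(n)=\mathcal L$ for all large $n$); Left weakly dominates if the period contains at least one $\mathcal L$ and no $\mathcal R$. -}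

module Defs where

open import Data.Nat using (ℕ; zero; suc; _+_; _∸_; _≤_; _<_)
open import Data.List using (List; map; upTo; length)
open import Data.List.Membership.Propositional using (_∈_)
open import Data.List.Relation.Unary.All using (All)
open import Data.List.Relation.Unary.Unique.Propositional using (Unique)
open import Data.Product using (Σ; ∃; _×_; _,_)
open import Function.Bundles using (_⇔_)
open import Relation.Nullary using (¬_)
open import Relation.Binary.PropositionalEquality using (_≡_)

block : ℕ → ℕ → List ℕ
block c k = map (λ i → c + suc i) (upTo k)

SetOfPositive : ℕ → List ℕ → Set
SetOfPositive k S = Unique S × All (λ s → 0 < s) S × length S ≡ k

SameSet : List ℕ → List ℕ → Set
SameSet A B = ∀ s → (s ∈ A) ⇔ (s ∈ B)

-- Winning for a fixed player ("mover") whose allowed subtractions are A,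
-- against an opponent whose allowed subtractions are B, on a heap of n tokens.
-- A player unable to move loses (normal play).
mutual
  data WinFirst (A B : List ℕ) : ℕ → Set where
    move : ∀ {n} s → s ∈ A → s ≤ n → WinSecond A B (n ∸ s) → WinFirst A B n

  data WinSecond (A B : List ℕ) : ℕ → Set where
    reply : ∀ {n} → (∀ s → s ∈ B → s ≤ n → WinFirst A B (n ∸ s)) → WinSecond A B n

data Outcome : Set where
  𝓛 𝓡 𝓝 𝓟 : Outcome

HasOutcome : List ℕ → List ℕ → ℕ → Outcome → Set
HasOutcome SL SR n 𝓛 = WinFirst SL SR n × WinSecond SL SR n
HasOutcome SL SR n 𝓡 = WinFirst SR SL n × WinSecond SR SL n
HasOutcome SL SR n 𝓝 = WinFirst SL SR n × WinFirst SR SL n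
HasOutcome SL SR n 𝓟 = WinSecond SL SR n × WinSecond SR SL n

PeriodicFrom : List ℕ → List ℕ → ℕ → ℕ → Set
PeriodicFrom SL SR n₀ p =
  0 < p × (∀ n → n₀ ≤ n → ∀ o → HasOutcome SL SR (n + p) o ⇔ HasOutcome SL SR n o)

StronglyDominates : List ℕ → List ℕ → Set
StronglyDominates SL SR = ∃ λ n₀ → ∀ n → n₀ ≤ n → HasOutcome SL SR n 𝓛

WeaklyDominates : List ℕ → List ℕ → Set
WeaklyDominates SL SR = Σ ℕ λ n₀ → Σ ℕ λ p →
  PeriodicFrom SL SR n₀ p
  × (∀ n → n₀ ≤ n → ¬ HasOutcome SL SR n 𝓡)
  × (∃ λ n → n₀ ≤ n × HasOutcome SL SR n 𝓛)

Impartial : List ℕ → List ℕ → Set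
Impartial SL SR = SameSet SL SR

-- A Left move from a heap n > k reaches one of the k consecutive heaps
-- n − k, …, n − 1.  If S_R is not a block, these cannot all lie in S_R (a
-- k-element set containing a block of k consecutive integers is that block),
-- so from every n ≥ 1 Left can move to a heap outside S_R, or empty the heap
-- when n ≤ k; and from a heap outside S_R every Right move leaves a non-empty
-- heap.  By well-founded induction Left wins moving first from every n ≥ 1 and
-- moving second from every n ∉ S_R, hence from every n > max S_R.
--
-- If S_R = {c+1, …, c+k}, the outcome of n depends only on r = n mod (c+k+1):
-- it is 𝓟 for r = 0, 𝓛 for 1 ≤ r ≤ c and 𝓝 for r > c.  Left moves to residue
-- 0 or r − k ≤ c, Right answers residue r ≤ c by returning to 1 ≤ r′ ≤ c + k
-- and takes residue r > c to 0; Left's moves from residue 0 land above c.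
module Submission where

open import Defs
open import Data.Nat using (ℕ; zero; suc; _+_; _*_; _∸_; _≤_; _<_; z≤n; s≤s; z<s; _≤?_)
open import Data.Nat.Properties
open import Data.Nat.DivMod using (_/_; _%_; m≡m%n+[m/n]*n; m%n<n; [m+n]%n≡m%n)
open import Data.Nat.Induction using (<-wellFounded)
open import Induction.WellFounded using (Acc; acc)
open import Data.List using (List; []; _∷_; upTo; length)
open import Data.List.Properties using (length-map; length-upTo)
open import Data.List.Membership.Propositional using (_∈_; _∉_; find)
open import Data.List.Membership.Propositional.Properties
  using (∈-map⁺; ∈-map⁻; ∈-upTo⁺; ∈-upTo⁻; ∈-∃++)
open import Data.List.Membership.DecPropositional _≟_ using (_∈?_)
open import Data.List.Relation.Binary.Subset.Propositional using (_⊆_)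
open import Data.List.Relation.Binary.Permutation.Propositional using (_↭_)
open import Data.List.Relation.Binary.Permutation.Propositional.Properties
  using (shift; ∈-resp-↭; ↭-length)
open import Data.List.Relation.Unary.All as All using (All)
open import Data.List.Relation.Unary.All.Properties using (¬Any⇒All¬; ¬All⇒Any¬)
open import Data.List.Relation.Unary.Any using (here; there)
open import Data.List.Relation.Unary.AllPairs using (_∷_)
open import Data.List.Relation.Unary.Unique.Propositional using (Unique)
import Data.List.Relation.Unary.Unique.Propositional.Properties as Unique
open import Data.List.Extrema.Nat using (max; xs≤max)
open import Data.Product using (∃; _×_; _,_; proj₁; proj₂)
open import Function.Base using (_∘_)
open import Function.Bundles using (_⇔_; mk⇔; Equivalence)
import Function.Properties.Equivalence as ⇔
open import Relation.Nullary using (¬_; yes; no; contradiction)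
open import Relation.Binary.PropositionalEquality
  using (_≡_; _≢_; refl; sym; trans; cong; subst; subst₂)

∈-block⁻ : ∀ {c k x} → x ∈ block c k → c < x × x ≤ c + k
∈-block⁻ {c} p with i , i∈upTo , refl ← ∈-map⁻ (λ i → c + suc i) p =
  m<m+n c z<s , +-monoʳ-≤ c (∈-upTo⁻ i∈upTo)

∈-block⁺ : ∀ {c k x} → c < x → x ≤ c + k → x ∈ block c k
∈-block⁺ {c} {k} c<x x≤c+k with i , refl ← m≤n⇒∃[o]m+o≡n c<x =
  subst (_∈ block c k) (+-suc c i)
    (∈-map⁺ (λ i → c + suc i)
      (∈-upTo⁺ (+-cancelˡ-≤ c _ _ (subst (_≤ c + k) (sym (+-suc c i)) x≤c+k))))

block-unique : ∀ c k → Unique (block c k)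
block-unique c k = Unique.map⁺ (λ eq → suc-injective (+-cancelˡ-≡ c _ _ eq)) (Unique.upTo⁺ k)

length-block : ∀ c k → length (block c k) ≡ k
length-block c k = trans (length-map (λ i → c + suc i) (upTo k)) (length-upTo k)

∈-block-reflect : ∀ {c k x} → x ∈ block c k →
                  suc k + c ∸ x ∈ block 0 k × suc k + c ∸ (suc k + c ∸ x) ≡ x
∈-block-reflect {c} {k} {x} x∈block =
  ∈-block⁺ (m<n⇒0<n∸m x<m) m∸x≤k , m∸[m∸n]≡n (<⇒≤ x<m)
  where
  c<x : c < x
  c<x = proj₁ (∈-block⁻ x∈block)
  x<m : x < suc k + c
  x<m = s≤s (subst (x ≤_) (+-comm c k) (proj₂ (∈-block⁻ x∈block)))
  m∸x≤k : suc k + c ∸ x ≤ k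
  m∸x≤k = ≤-trans (∸-monoʳ-≤ (suc k + c) c<x) (≤-reflexive (m+n∸n≡m k c))

∈⇒∃↭ : ∀ {x : ℕ} {ys} → x ∈ ys → ∃ λ ys′ → ys ↭ x ∷ ys′
∈⇒∃↭ x∈ys with ys₁ , ys₂ , refl ← ∈-∃++ x∈ys = _ , shift _ ys₁ ys₂

unique-⊆⇒length≤ : ∀ {xs ys : List ℕ} → Unique xs → xs ⊆ ys → length xs ≤ length ys
unique-⊆⇒length≤ {[]}     _               _     = z≤n
unique-⊆⇒length≤ {x ∷ xs} (x∉xs ∷ xs-uniq) xs⊆ys with ys′ , ys↭ ← ∈⇒∃↭ (xs⊆ys (here refl)) =
  ≤-trans (s≤s (unique-⊆⇒length≤ xs-uniq xs⊆ys′)) (≤-reflexive (sym (↭-length ys↭)))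
  where
  xs⊆ys′ : xs ⊆ ys′
  xs⊆ys′ z∈xs with ∈-resp-↭ ys↭ (xs⊆ys (there z∈xs))
  ... | here z≡x    = contradiction (sym z≡x) (All.lookup x∉xs z∈xs)
  ... | there z∈ys′ = z∈ys′

block⊆⇒sameSet : ∀ {c k S} → Unique S → length S ≡ k → block c k ⊆ S → SameSet S (block c k)
block⊆⇒sameSet {c} {k} {S} S-uniq |S|≡k block⊆S s = mk⇔ S⊆block block⊆S
  where
  S⊆block : s ∈ S → s ∈ block c k
  S⊆block s∈S with s ∈? block c k
  ... | yes s∈block = s∈block
  ... | no  s∉block = contradiction k<k (n≮n k)
    where
    k<k : k < k
    k<k = subst₂ _≤_ (cong suc (length-block c k)) |S|≡k
            (unique-⊆⇒length≤ (¬Any⇒All¬ _ s∉block ∷ block-unique c k)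
              λ { (here refl) → s∈S ; (there z∈block) → block⊆S z∈block })

mutual
  winFirst⇒¬winSecond : ∀ {A B n} → WinFirst A B n → ¬ WinSecond B A n
  winFirst⇒¬winSecond (move s s∈A s≤n w) (reply f) = winSecond⇒¬winFirst w (f s s∈A s≤n)

  winSecond⇒¬winFirst : ∀ {A B n} → WinSecond A B n → ¬ WinFirst B A n
  winSecond⇒¬winFirst (reply f) (move s s∈B s≤n w) = winFirst⇒¬winSecond (f s s∈B s≤n) w

outcome-unique : ∀ {A B n} o o′ → HasOutcome A B n o → HasOutcome A B n o′ → o ≡ o′
outcome-unique 𝓛 𝓛 _       _       = refl
outcome-unique 𝓡 𝓡 _       _       = refl
outcome-unique 𝓝 𝓝 _       _       = refl
outcome-unique 𝓟 𝓟 _       _       = refl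
outcome-unique 𝓛 𝓡 (l , _) (_ , r) = contradiction r (winFirst⇒¬winSecond l)
outcome-unique 𝓛 𝓝 (_ , l) (_ , r) = contradiction l (winFirst⇒¬winSecond r)
outcome-unique 𝓛 𝓟 (l , _) (_ , r) = contradiction r (winFirst⇒¬winSecond l)
outcome-unique 𝓡 𝓛 (r , _) (_ , l) = contradiction l (winFirst⇒¬winSecond r)
outcome-unique 𝓡 𝓝 (_ , r) (l , _) = contradiction r (winFirst⇒¬winSecond l)
outcome-unique 𝓡 𝓟 (r , _) (l , _) = contradiction l (winFirst⇒¬winSecond r)
outcome-unique 𝓝 𝓛 (_ , r) (_ , l) = contradiction l (winFirst⇒¬winSecond r)
outcome-unique 𝓝 𝓡 (l , _) (_ , r) = contradiction r (winFirst⇒¬winSecond l)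
outcome-unique 𝓝 𝓟 (l , _) (_ , r) = contradiction r (winFirst⇒¬winSecond l)
outcome-unique 𝓟 𝓛 (_ , r) (l , _) = contradiction r (winFirst⇒¬winSecond l)
outcome-unique 𝓟 𝓡 (l , _) (r , _) = contradiction l (winFirst⇒¬winSecond r)
outcome-unique 𝓟 𝓝 (l , _) (_ , r) = contradiction l (winFirst⇒¬winSecond r)

sameOutcome⇒hasOutcome⇔ : ∀ {A B m n} o₀ → HasOutcome A B m o₀ → HasOutcome A B n o₀ →
                          ∀ o → HasOutcome A B m o ⇔ HasOutcome A B n o
sameOutcome⇒hasOutcome⇔ {A} {B} {m} {n} o₀ hm hn o =
  mk⇔ (λ h → subst (HasOutcome A B n) (outcome-unique o₀ o hm h) hn)
      (λ h → subst (HasOutcome A B m) (outcome-unique o₀ o hn h) hm)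

module NonBlock (k : ℕ) (SR : List ℕ) (SR-unique : Unique SR) (SR-positive : All (0 <_) SR)
                (|SR|≡k : length SR ≡ k) (SR-not-block : ¬ (∃ λ c → SameSet SR (block c k))) where

  SL : List ℕ
  SL = block 0 k

  someMoveAvoidsSR : ∀ {n} → k < n → ¬ All (λ s → n ∸ s ∈ SR) SL
  someMoveAvoidsSR k<n allInSR with c , refl ← m≤n⇒∃[o]m+o≡n k<n =
    SR-not-block (c , block⊆⇒sameSet SR-unique |SR|≡k block⊆SR)
    where
    block⊆SR : block c k ⊆ SR
    block⊆SR x∈block with s∈SL , n∸s≡x ← ∈-block-reflect x∈block =
      subst (_∈ SR) n∸s≡x (All.lookup allInSR s∈SL)

  mutual
    leftWinsFirst : ∀ {n} → Acc _<_ n → 1 ≤ n → WinFirst SL SR n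
    leftWinsFirst {n} (acc rs) 1≤n with n ≤? k
    ... | yes n≤k = move n (∈-block⁺ 1≤n n≤k) ≤-refl
                      (leftWinsSecond (rs (∸-monoʳ-< 1≤n ≤-refl)) n∸n∉SR)
      where
      n∸n∉SR : n ∸ n ∉ SR
      n∸n∉SR n∸n∈SR = n≮n 0 (subst (0 <_) (n∸n≡0 n) (All.lookup SR-positive n∸n∈SR))
    ... | no n≰k
      with s , s∈SL , n∸s∉SR ← find (¬All⇒Any¬ (λ s → n ∸ s ∈? SR) SL (someMoveAvoidsSR (≰⇒> n≰k))) =
      move s s∈SL s≤n (leftWinsSecond (rs (∸-monoʳ-< 0<s s≤n)) n∸s∉SR)
      where
      0<s : 0 < s
      0<s = proj₁ (∈-block⁻ s∈SL)
      s≤n : s ≤ n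
      s≤n = ≤-trans (proj₂ (∈-block⁻ s∈SL)) (<⇒≤ (≰⇒> n≰k))

    leftWinsSecond : ∀ {n} → Acc _<_ n → n ∉ SR → WinSecond SL SR n
    leftWinsSecond {n} (acc rs) n∉SR = reply λ t t∈SR t≤n →
      let t<n = ≤∧≢⇒< t≤n (λ { refl → n∉SR t∈SR }) in
      leftWinsFirst (rs (∸-monoʳ-< (All.lookup SR-positive t∈SR) t≤n)) (m<n⇒0<n∸m t<n)

  stronglyDominates : StronglyDominates SL SR
  stronglyDominates = suc (max 0 SR) , λ n n>max →
    let n∉SR : n ∉ SR
        n∉SR n∈SR = <⇒≱ n>max (All.lookup (xs≤max 0 SR) n∈SR)
    in leftWinsFirst (<-wellFounded n) (≤-trans (s≤s z≤n) n>max) ,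
       leftWinsSecond (<-wellFounded n) n∉SR

r+m∸t<m : ∀ {r t} m → r < t → t ≤ r + m → r + m ∸ t < m
r+m∸t<m {r} m r<t t≤r+m = <-≤-trans (∸-monoʳ-< r<t t≤r+m) (≤-reflexive (m+n∸m≡n r m))

module BlockGame (k c : ℕ) (1≤k : 1 ≤ k) (SR : List ℕ) (SR≈block : SameSet SR (block c k)) where

  SL : List ℕ
  SL = block 0 k

  period : ℕ
  period = suc (c + k)

  ∈SR⁻ : ∀ {t} → t ∈ SR → c < t × t ≤ c + k
  ∈SR⁻ t∈SR = ∈-block⁻ (Equivalence.to (SR≈block _) t∈SR)

  ∈SR⁺ : ∀ {t} → c < t → t ≤ c + k → t ∈ SR
  ∈SR⁺ c<t t≤c+k = Equivalence.from (SR≈block _) (∈-block⁺ c<t t≤c+k)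

  -- Heaps are written r + q * period.  The first-player lemmas only call the
  -- second-player ones at the same q, which call the former at q − 1.
  mutual
    leftWinsFirst : ∀ q {r} → 1 ≤ r → r < period → WinFirst SL SR (r + q * period)
    leftWinsFirst q {r} 1≤r (s≤s r≤c+k) with r ≤? k
    ... | yes r≤k = move r (∈-block⁺ 1≤r r≤k) (m≤m+n r _)
          (subst (WinSecond SL SR) (sym (m+n∸m≡n r (q * period))) (leftWinsSecond q z≤n))
    ... | no r≰k = move k (∈-block⁺ 1≤k ≤-refl) (≤-trans k≤r (m≤m+n r _))
          (subst (WinSecond SL SR) (sym (+-∸-comm (q * period) k≤r)) (leftWinsSecond q r∸k≤c))
      where
      k≤r : k ≤ r
      k≤r = <⇒≤ (≰⇒> r≰k)
      r∸k≤c : r ∸ k ≤ c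
      r∸k≤c = m≤n+o⇒m∸n≤o r k (subst (r ≤_) (+-comm c k) r≤c+k)

    leftWinsSecond : ∀ q {r} → r ≤ c → WinSecond SL SR (r + q * period)
    leftWinsSecond zero {r} r≤c = reply λ t t∈SR t≤r+0 →
      contradiction (subst (t ≤_) (+-identityʳ r) t≤r+0) (<⇒≱ (≤-<-trans r≤c (proj₁ (∈SR⁻ t∈SR))))
    leftWinsSecond (suc q) {r} r≤c = reply λ t t∈SR _ →
      let c<t , t≤c+k = ∈SR⁻ t∈SR
          t<r+period = ≤-trans (s≤s t≤c+k) (m≤n+m period r)
      in subst (WinFirst SL SR) (heapAfterMove (<⇒≤ t<r+period))
           (leftWinsFirst q (m<n⇒0<n∸m t<r+period)
             (r+m∸t<m period (≤-<-trans r≤c c<t) (<⇒≤ t<r+period)))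
      where
      heapAfterMove : ∀ {t} → t ≤ r + period → r + period ∸ t + q * period ≡ r + suc q * period ∸ t
      heapAfterMove {t} t≤ = trans (sym (+-∸-comm (q * period) t≤)) (cong (_∸ t) (+-assoc r period (q * period)))

    rightWinsFirst : ∀ q {r} → c < r → r < period → WinFirst SR SL (r + q * period)
    rightWinsFirst q {r} c<r (s≤s r≤c+k) = move r (∈SR⁺ c<r r≤c+k) (m≤m+n r _)
      (subst (WinSecond SR SL) (sym (m+n∸m≡n r (q * period))) (rightWinsSecond q))

    rightWinsSecond : ∀ q → WinSecond SR SL (q * period)
    rightWinsSecond zero = reply λ s s∈SL s≤0 → contradiction s≤0 (<⇒≱ (proj₁ (∈-block⁻ s∈SL)))
    rightWinsSecond (suc q) = reply λ s s∈SL _ →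
      let 0<s , s≤k = ∈-block⁻ s∈SL
          s≤period = ≤-trans s≤k (≤-trans (m≤n+m k c) (n≤1+n (c + k)))
      in subst (WinFirst SR SL) (sym (+-∸-comm (q * period) s≤period))
           (rightWinsFirst q (c<period∸s s≤k) (∸-monoʳ-< 0<s s≤period))
      where
      c<period∸s : ∀ {s} → s ≤ k → c < period ∸ s
      c<period∸s s≤k = ≤-trans (≤-reflexive (sym (m+n∸n≡m (suc c) k))) (∸-monoʳ-≤ period s≤k)

  residueOutcome : ℕ → Outcome
  residueOutcome zero = 𝓟
  residueOutcome (suc r) with suc r ≤? c
  ... | yes _ = 𝓛
  ... | no  _ = 𝓝

  residueOutcome≢𝓡 : ∀ r → residueOutcome r ≢ 𝓡
  residueOutcome≢𝓡 zero ()
  residueOutcome≢𝓡 (suc r) with suc r ≤? c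
  ... | yes _ = λ ()
  ... | no  _ = λ ()

  hasResidueOutcome : ∀ q r → r < period → HasOutcome SL SR (r + q * period) (residueOutcome r)
  hasResidueOutcome q zero    _       = leftWinsSecond q z≤n , rightWinsSecond q
  hasResidueOutcome q (suc r) r<period with suc r ≤? c
  ... | yes r≤c = leftWinsFirst q z<s r<period , leftWinsSecond q r≤c
  ... | no  r≰c = leftWinsFirst q z<s r<period , rightWinsFirst q (≰⇒> r≰c) r<period

  outcome : ∀ n → HasOutcome SL SR n (residueOutcome (n % period))
  outcome n = subst (λ m → HasOutcome SL SR m (residueOutcome (n % period)))
                (sym (m≡m%n+[m/n]*n n period))
                (hasResidueOutcome (n / period) (n % period) (m%n<n n period))

  periodic : PeriodicFrom SL SR 0 period
  periodic = z<s , λ n _ → sameOutcome⇒hasOutcome⇔ (residueOutcome (n % period))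
    (subst (HasOutcome SL SR (n + period) ∘ residueOutcome) ([m+n]%n≡m%n n period) (outcome (n + period)))
    (outcome n)

  weaklyDominates : 0 < c → WeaklyDominates SL SR
  weaklyDominates 0<c = 0 , period , periodic ,
    (λ n _ n-is-𝓡 → residueOutcome≢𝓡 (n % period) (outcome-unique _ 𝓡 (outcome n) n-is-𝓡)) ,
    (1 , z≤n , leftWinsFirst 0 z<s (s≤s (≤-trans 0<c (m≤m+n c k))) , leftWinsSecond 0 0<c)

mainTheorem7 : (k : ℕ) → 1 ≤ k → (SR : List ℕ) → SetOfPositive k SR →
    ((c : ℕ) → SameSet SR (block c k) →
        (0 < c → WeaklyDominates (block 0 k) SR) × (c ≡ 0 → Impartial (block 0 k) SR))
    × (¬ (∃ λ c → SameSet SR (block c k)) → StronglyDominates (block 0 k) SR)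
mainTheorem7 k 1≤k SR (SR-unique , SR-positive , |SR|≡k) =
  (λ c SR≈block → BlockGame.weaklyDominates k c 1≤k SR SR≈block , λ { refl → ⇔.sym ∘ SR≈block }) ,
  NonBlock.stronglyDominates k SR SR-unique SR-positive |SR|≡k
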